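{- Let $(T=(V,E),\mathcal L)$ be a list edge coloring instance on a tree $T$ rooted at $r$, where $r$ has children $v_1,\dots,v_d$, $e_i=\{r,v_i\}$, and $T_i$ is the subtree rooted at $v_i$ (with lists restricted from $\mathcal L$). For each $i$ let $\mathbf p_i=\big(\Pr_{T_i}[c(E_{T_i}(v_i))=\tau]\big)_{\tau\in C_{v_i}}$. Then for every $\pi\in C_r$, \[\Pr_T[c(E(r))=\pi]=\frac{\prod_{i=1}^d\sum_{\tau\in C_{v_i}:\,\pi(e_i)\notin\tau}\mathbf p_i(\tau)}{\sum_{\rho\in C_r}\prod_{i=1}^d\sum_{\tau\in C_{v_i}:\,\rho(e_i)\notin\tau}\mathbf p_i(\tau)}.\]
   Context: Lists $\mathcal L(e)\subseteq[q]$; a proper edge coloring assigns each edge a color from its list, distinct on distinct edges sharing an endpoint. For a vertex $u$, $T_u$ is the subtree rooted at $u$ and $E_{T_u}(u)$ is the set of edges from $u$ to its children (the "broom" at $u$); $C_u$ is the set of proper partial colorings of $E_{T_u}(u)$ (each edge a color from its list, pairwise distinct colors). $\Pr_{T}[\cdot]$ and $\Pr_{T_i}[\cdot]$ denote probabilities under uniformly random proper edge colorings $c$ of $T$, resp. of $T_i$; "$c\notin\tau$" means color $c$ is not used by $\tau$. Assume these instances have at least one proper coloring. -}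

module Defs where

open import Data.Nat as ℕ using (ℕ; zero; suc)
open import Data.Fin using (Fin; zero; suc)
open import Data.Fin.Properties using (_≟_)
open import Data.Fin.Subset using (Subset)
open import Data.Vec using (lookup)
open import Data.Bool using (Bool; true; false; _∧_; not; if_then_else_)
open import Data.List using (List; []; _∷_; map; concatMap; filter; length; foldr; allFin)
open import Data.Product using (Σ; _×_; _,_; proj₁; proj₂)
open import Data.Integer using (+_)
open import Data.Rational using (ℚ; 0ℚ; 1ℚ; _+_; _*_; _/_)
open import Relation.Binary.PropositionalEquality using (_≡_)
open import Relation.Nullary.Decidable using (⌊_⌋)

-- A rooted tree whose edges to children carry lists L(e) ⊆ [q] (as subsets of Fin q).
-- node d L ch : root with d children; the edge e_i to child i has list L i,
-- and ch i is the subtree rooted at the i-th child (lists restricted from the whole tree).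
data LTree (q : ℕ) : Set where
  node : (d : ℕ) → (Fin d → Subset q) → (Fin d → LTree q) → LTree q

sumℚ : List ℚ → ℚ
sumℚ = foldr _+_ 0ℚ

prodℚ : List ℚ → ℚ
prodℚ = foldr _*_ 1ℚ

all : {A : Set} → (A → Bool) → List A → Bool
all p [] = true
all p (x ∷ xs) = p x ∧ all p xs

module _ {q : ℕ} where

  deg : LTree q → ℕ
  deg (node d _ _) = d

  Coloring : LTree q → Set
  Coloring (node d L ch) = (Fin d → Fin q) × ((i : Fin d) → Coloring (ch i))

  rootColors : (t : LTree q) → Coloring t → Fin (deg t) → Fin q
  rootColors (node d L ch) c = proj₁ c

  allFinB : (n : ℕ) → (Fin n → Bool) → Bool
  allFinB n p = all p (allFin n)

  eqFun : {n : ℕ} → (Fin n → Fin q) → (Fin n → Fin q) → Bool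
  eqFun {n} f g = allFinB n (λ j → ⌊ f j ≟ g j ⌋)

  notUsed : {n : ℕ} → Fin q → (Fin n → Fin q) → Bool
  notUsed {n} a τ = allFinB n (λ j → not ⌊ a ≟ τ j ⌋)

  isBroomColoring : (t : LTree q) → (Fin (deg t) → Fin q) → Bool
  isBroomColoring (node d L ch) τ =
    allFinB d (λ i → lookup (L i) (τ i)) ∧
    allFinB d (λ i → allFinB d (λ j → ⌊ i ≟ j ⌋ ∨' not ⌊ τ i ≟ τ j ⌋))
    where
    _∨'_ : Bool → Bool → Bool
    true ∨' _ = true
    false ∨' b = b

  isProper : (t : LTree q) → Coloring t → Bool
  isProper (node d L ch) (f , cs) =
    isBroomColoring (node d L ch) f ∧
    allFinB d (λ i → notUsed (f i) (rootColors (ch i) (cs i))) ∧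
    allFinB d (λ i → isProper (ch i) (cs i))

  allFuns : {A : Set} → List A → (n : ℕ) → List (Fin n → A)
  allFuns as zero = (λ ()) ∷ []
  allFuns as (suc n) =
    concatMap (λ a → map (λ f → λ { zero → a ; (suc i) → f i }) (allFuns as n)) as

  allDep : (n : ℕ) (B : Fin n → Set) → ((i : Fin n) → List (B i)) → List ((i : Fin n) → B i)
  allDep zero B ls = (λ ()) ∷ []
  allDep (suc n) B ls =
    concatMap (λ b → map (λ f → λ { zero → b ; (suc i) → f i })
                         (allDep n (λ i → B (suc i)) (λ i → ls (suc i))))
              (ls zero)

  -- every coloring of t (proper or not) appears in this list exactly once
  allColorings : (t : LTree q) → List (Coloring t)
  allColorings (node d L ch) =
    concatMap (λ f → map (λ cs → (f , cs)) (allDep d (λ i → Coloring (ch i)) (λ i → allColorings (ch i))))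
              (allFuns (allFin q) d)

  properColorings : (t : LTree q) → List (Coloring t)
  properColorings t = filter (λ c → isProper t c ≟B true) (allColorings t)
    where
    open import Data.Bool.Properties renaming (_≟_ to _≟B_)

  HasProperColoring : LTree q → Set
  HasProperColoring t = Σ (Coloring t) (λ c → isProper t c ≡ true)

  C : (t : LTree q) → List (Fin (deg t) → Fin q)
  C t = filter (λ τ → isBroomColoring t τ ≟B true) (allFuns (allFin q) (deg t))
    where
    open import Data.Bool.Properties renaming (_≟_ to _≟B_)

  -- Pr_t[E] for c a uniformly random proper edge coloring of t
  -- (defined as 0 if t has no proper coloring; never used in that case)
  Pr : (t : LTree q) → (Coloring t → Bool) → ℚ
  Pr t E with length (properColorings t)
  ... | zero = 0ℚ
  ... | suc n = (+ length (filter (λ c → E c ≟B true) (properColorings t))) / suc n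
    where
    open import Data.Bool.Properties renaming (_≟_ to _≟B_)

  pvec : (t : LTree q) → (Fin (deg t) → Fin q) → ℚ
  pvec t τ = Pr t (λ c → eqFun (rootColors t c) τ)

  weight : (d : ℕ) → (Fin d → LTree q) → (Fin d → Fin q) → ℚ
  weight d ch ρ =
    prodℚ (map (λ i → sumℚ (map (pvec (ch i))
                                (filter (λ τ → notUsed (ρ i) τ ≟B true) (C (ch i)))))
               (allFin d))
    where
    open import Data.Bool.Properties renaming (_≟_ to _≟B_)

{-# OPTIONS --safe #-}
module Submission where

-- Everything is counted rather than measured. Let N_u be the number of proper colorings of T_u and
-- A_u(a) the number of those whose root edges avoid the color a. A proper coloring of T whose root
-- broom is π amounts to choosing, for every child v_i, a proper coloring of T_i whose root edges
-- avoid π(e_i); so exactly ∏ᵢ A_{T_i}(π(e_i)) colorings have c(E(r)) = π, and N_T is the sum of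
-- these products over ρ ∈ C_r. Splitting the colorings counted by A_{T_i}(a) according to their root
-- broom τ gives Σ_{τ : a ∉ τ} p_i(τ) = A_{T_i}(a) / N_{T_i}. Hence the numerator and the denominator
-- of the formula are ∏ᵢ A_{T_i}(π(e_i)) and N_T, both divided by ∏ᵢ N_{T_i}.

open import Defs

open import Data.Bool using (Bool; true; false; _∧_; not)
open import Data.Bool.Properties using (⇔→≡) renaming (_≟_ to _≟ᵇ_)
open import Data.Fin using (Fin; zero; suc)
open import Data.Fin.Properties using (_≟_)
open import Data.Fin.Subset using (Subset)
import Data.Integer as ℤ
open import Data.Integer.Properties using (pos-+; pos-*)
open import Data.List using (List; []; _∷_; _++_; map; concatMap; filter; length; allFin; tabulate)
open import Data.List.Membership.Propositional using (_∈_)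
open import Data.List.Membership.Propositional.Properties using (∈-allFin)
open import Data.List.Properties using (map-cong; map-++; map-∘; map-tabulate)
open import Data.List.Relation.Unary.Any using (here; there)
open import Data.Nat using (ℕ; zero; suc; pred; _+_; _*_; _≤_; _<_; z≤n; >-nonZero)
open import Data.Nat.ListAction using (sum)
open import Data.Nat.ListAction.Properties using (sum-++)
open import Data.Nat.Properties
  using ( +-identityʳ; *-identityˡ; *-identityʳ; *-zeroʳ; *-comm; *-assoc; *-distribˡ-+; *-distribʳ-+
        ; +-mono-≤; *-mono-≤; *-monoˡ-≤; *-monoʳ-≤; ≤-refl; ≤-reflexive; ≤-trans; module ≤-Reasoning; suc-pred
        ; *-1-commutativeMonoid; +-commutativeSemigroup; *-commutativeSemigroup )
open import Data.Product using (Σ; ∃; _×_; _,_; proj₁; proj₂)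
open import Data.Rational as ℚ using (ℚ; 1ℚ; NonZero; _÷_; 1/_; fromℚᵘ; toℚᵘ)
import Data.Rational.Properties as ℚₚ
open import Data.Rational.Unnormalised as ℚᵘ using (mkℚᵘ; *≡*)
import Data.Rational.Unnormalised.Properties as ℚᵘₚ
open import Data.Sum using (_⊎_; inj₁; inj₂)
open import Data.Vec using (lookup)
open import Data.Vec.Functional using (foldr)
open import Function using (id; _∘_)
open import Function.Bundles using (mk⇔)
open import Relation.Binary.Core using (_Preserves_⟶_)
open import Relation.Binary.PropositionalEquality
  using (_≡_; refl; sym; trans; cong; cong₂; subst; _≗_; module ≡-Reasoning)
open import Relation.Nullary using (yes; no; contradiction)
open import Relation.Nullary.Decidable using (⌊_⌋; ⌊⌋-map′)
open import Algebra.Properties.CommutativeMonoid.Sum *-1-commutativeMonoid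
  using () renaming (sum to ∏; sum-cong-≗ to ∏-cong; ∑-distrib-+ to ∏-distrib-*)
open import Algebra.Properties.CommutativeSemigroup +-commutativeSemigroup
  using () renaming (interchange to +-interchange)
open import Algebra.Properties.CommutativeSemigroup *-commutativeSemigroup
  using () renaming (x∙yz≈y∙zx to x*yz≡y*zx)

private
  variable
    A B Z : Set

-- Finite sums over lists

∑ : List A → (A → ℕ) → ℕ
∑ xs f = sum (map f xs)

infix 5 ∑
syntax ∑ xs (λ x → e) = ∑[ x ∈ xs ] e

∑-cong : ∀ (xs : List A) {f g : A → ℕ} → f ≗ g → ∑ xs f ≡ ∑ xs g
∑-cong xs f≗g = cong sum (map-cong f≗g xs)

∑-map : ∀ (g : A → B) (xs : List A) (f : B → ℕ) → ∑ (map g xs) f ≡ ∑[ x ∈ xs ] f (g x)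
∑-map g xs f = cong sum (sym (map-∘ xs))

∑-++ : ∀ (xs ys : List A) (f : A → ℕ) → ∑ (xs ++ ys) f ≡ ∑ xs f + ∑ ys f
∑-++ xs ys f = trans (cong sum (map-++ f xs ys)) (sum-++ (map f xs) (map f ys))

∑-concatMap-map : ∀ (k : A → B → Z) (xs : List A) (ys : List B) (f : Z → ℕ) →
  ∑ (concatMap (λ x → map (k x) ys) xs) f ≡ ∑[ x ∈ xs ] ∑[ y ∈ ys ] f (k x y)
∑-concatMap-map k []       ys f = refl
∑-concatMap-map k (x ∷ xs) ys f =
  trans (∑-++ (map (k x) ys) _ f) (cong₂ _+_ (∑-map (k x) ys f) (∑-concatMap-map k xs ys f))

*-distribˡ-∑ : ∀ c (xs : List A) (f : A → ℕ) → c * ∑ xs f ≡ ∑[ x ∈ xs ] c * f x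
*-distribˡ-∑ c []       f = *-zeroʳ c
*-distribˡ-∑ c (x ∷ xs) f = trans (*-distribˡ-+ c (f x) _) (cong (c * f x +_) (*-distribˡ-∑ c xs f))

*-distribʳ-∑ : ∀ c (xs : List A) (f : A → ℕ) → ∑ xs f * c ≡ ∑[ x ∈ xs ] f x * c
*-distribʳ-∑ c []       f = refl
*-distribʳ-∑ c (x ∷ xs) f = trans (*-distribʳ-+ c (f x) _) (cong (f x * c +_) (*-distribʳ-∑ c xs f))

∑-distrib-+ : ∀ (xs : List A) (f g : A → ℕ) → ∑[ x ∈ xs ] (f x + g x) ≡ ∑ xs f + ∑ xs g
∑-distrib-+ []       f g = refl
∑-distrib-+ (x ∷ xs) f g =
  trans (cong (f x + g x +_) (∑-distrib-+ xs f g)) (+-interchange (f x) (g x) (∑ xs f) (∑ xs g))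

∑-zero : ∀ (xs : List A) → ∑[ x ∈ xs ] 0 ≡ 0
∑-zero []       = refl
∑-zero (x ∷ xs) = ∑-zero xs

∑-comm : ∀ (xs : List A) (ys : List B) (f : A → B → ℕ) →
  ∑[ x ∈ xs ] ∑[ y ∈ ys ] f x y ≡ ∑[ y ∈ ys ] ∑[ x ∈ xs ] f x y
∑-comm []       ys f = sym (∑-zero ys)
∑-comm (x ∷ xs) ys f =
  trans (cong (∑ ys (f x) +_) (∑-comm xs ys f)) (sym (∑-distrib-+ ys (f x) _))

∑-mono-≤ : ∀ (xs : List A) {f g : A → ℕ} → (∀ x → f x ≤ g x) → ∑ xs f ≤ ∑ xs g
∑-mono-≤ []       f≤g = z≤n
∑-mono-≤ (x ∷ xs) f≤g = +-mono-≤ (f≤g x) (∑-mono-≤ xs f≤g)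

∑-allFin-suc : ∀ {n} (f : Fin (suc n) → ℕ) →
  ∑ (allFin (suc n)) f ≡ f zero + (∑[ i ∈ allFin n ] f (suc i))
∑-allFin-suc f =
  cong (λ xs → f zero + sum xs) (trans (map-tabulate suc f) (sym (map-tabulate id (f ∘ suc))))

∏-mono-≤ : ∀ {n} {f g : Fin n → ℕ} → (∀ i → f i ≤ g i) → ∏ f ≤ ∏ g
∏-mono-≤ {zero}  f≤g = ≤-refl
∏-mono-≤ {suc n} f≤g = *-mono-≤ (f≤g zero) (∏-mono-≤ (f≤g ∘ suc))

𝟙 : Bool → ℕ
𝟙 true  = 1
𝟙 false = 0

𝟙-∧ : ∀ a b → 𝟙 (a ∧ b) ≡ 𝟙 a * 𝟙 b
𝟙-∧ true  b = sym (+-identityʳ (𝟙 b))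
𝟙-∧ false b = refl

𝟙-*-≤ : ∀ b n → 𝟙 b * n ≤ n
𝟙-*-≤ true  n = ≤-reflexive (+-identityʳ n)
𝟙-*-≤ false n = z≤n

∑-filter : ∀ (b : A → Bool) (xs : List A) (f : A → ℕ) →
  ∑ (filter (λ x → b x ≟ᵇ true) xs) f ≡ ∑[ x ∈ xs ] 𝟙 (b x) * f x
∑-filter b []       f = refl
∑-filter b (x ∷ xs) f with b x
... | true  = cong₂ _+_ (sym (+-identityʳ (f x))) (∑-filter b xs f)
... | false = ∑-filter b xs f

length-filter : ∀ (b : A → Bool) (xs : List A) →
  length (filter (λ x → b x ≟ᵇ true) xs) ≡ ∑[ x ∈ xs ] 𝟙 (b x)
length-filter b []       = refl
length-filter b (x ∷ xs) with b x
... | true  = cong suc (length-filter b xs)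
... | false = length-filter b xs

∑-allFin-select : ∀ {n} (b : Fin n) (g : Fin n → ℕ) →
  ∑[ a ∈ allFin n ] 𝟙 ⌊ a ≟ b ⌋ * g a ≡ g b
∑-allFin-select {suc n} zero g = begin
  ∑[ a ∈ allFin (suc n) ] 𝟙 ⌊ a ≟ zero ⌋ * g a
    ≡⟨ ∑-allFin-suc (λ a → 𝟙 ⌊ a ≟ zero ⌋ * g a) ⟩
  1 * g zero + (∑[ i ∈ allFin n ] 0)
    ≡⟨ cong₂ _+_ (*-identityˡ (g zero)) (∑-zero (allFin n)) ⟩
  g zero + 0
    ≡⟨ +-identityʳ (g zero) ⟩
  g zero ∎
  where open ≡-Reasoning
∑-allFin-select {suc n} (suc b) g = begin
  ∑[ a ∈ allFin (suc n) ] 𝟙 ⌊ a ≟ suc b ⌋ * g a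
    ≡⟨ ∑-allFin-suc (λ a → 𝟙 ⌊ a ≟ suc b ⌋ * g a) ⟩
  ∑[ a ∈ allFin n ] 𝟙 ⌊ suc a ≟ suc b ⌋ * g (suc a)
    ≡⟨ ∑-cong (allFin n) (λ a → cong (λ x → 𝟙 x * g (suc a)) (⌊⌋-map′ _ _ (a ≟ b))) ⟩
  ∑[ a ∈ allFin n ] 𝟙 ⌊ a ≟ b ⌋ * g (suc a)
    ≡⟨ ∑-allFin-select b (g ∘ suc) ⟩
  g (suc b) ∎
  where open ≡-Reasoning

∧-true : ∀ {a b} → a ∧ b ≡ true → a ≡ true × b ≡ true
∧-true {true} b≡true = refl , b≡true

∧-separates : ∀ {a b a′ b′} → a ∧ b ≡ true → a′ ∧ b′ ≡ false →
  (a ≡ true × a′ ≡ false) ⊎ (b ≡ true × b′ ≡ false)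
∧-separates {a′ = false} ab≡true a′b′≡false = inj₁ (proj₁ (∧-true ab≡true) , refl)
∧-separates {a′ = true}  ab≡true a′b′≡false = inj₂ (proj₂ (∧-true ab≡true) , a′b′≡false)

all-cong : ∀ {p p′ : A → Bool} (xs : List A) → p ≗ p′ → all p xs ≡ all p′ xs
all-cong []       p≗p′ = refl
all-cong (x ∷ xs) p≗p′ = cong₂ _∧_ (p≗p′ x) (all-cong xs p≗p′)

all-true : ∀ {p : A → Bool} {xs x} → all p xs ≡ true → x ∈ xs → p x ≡ true
all-true {xs = y ∷ ys} all≡true (here refl)  = proj₁ (∧-true all≡true)
all-true {xs = y ∷ ys} all≡true (there x∈ys) = all-true (proj₂ (∧-true all≡true)) x∈ys

all-separates : ∀ {p p′ : A → Bool} (xs : List A) → all p xs ≡ true → all p′ xs ≡ false →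
  ∃ λ x → p x ≡ true × p′ x ≡ false
all-separates []       all-p ()
all-separates (x ∷ xs) all-p all-p′ with ∧-separates all-p all-p′
... | inj₁ separated          = x , separated
... | inj₂ (rest-p , rest-p′) = all-separates xs rest-p rest-p′

𝟙-all-tabulate : ∀ {n} (p : A → Bool) (f : Fin n → A) →
  𝟙 (all p (tabulate f)) ≡ ∏ (λ i → 𝟙 (p (f i)))
𝟙-all-tabulate {n = zero}  p f = refl
𝟙-all-tabulate {n = suc n} p f =
  trans (𝟙-∧ (p (f zero)) _) (cong (𝟙 (p (f zero)) *_) (𝟙-all-tabulate p (f ∘ suc)))

⌊≟⌋-sym : ∀ {n} (x y : Fin n) → ⌊ x ≟ y ⌋ ≡ ⌊ y ≟ x ⌋
⌊≟⌋-sym x y with x ≟ y | y ≟ x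
... | yes _   | yes _   = refl
... | no _    | no _    = refl
... | yes x≡y | no y≢x  = contradiction (sym x≡y) y≢x
... | no x≢y  | yes y≡x = contradiction (sym y≡x) x≢y

-- Fractions with positive denominators

fromℚᵘ-homo-+ : ∀ p r → fromℚᵘ (p ℚᵘ.+ r) ≡ fromℚᵘ p ℚ.+ fromℚᵘ r
fromℚᵘ-homo-+ p r = begin
  fromℚᵘ (p ℚᵘ.+ r)
    ≡⟨ ℚₚ.fromℚᵘ-cong (ℚᵘₚ.+-cong (ℚᵘₚ.≃-sym (ℚₚ.toℚᵘ-fromℚᵘ p))
                                  (ℚᵘₚ.≃-sym (ℚₚ.toℚᵘ-fromℚᵘ r))) ⟩
  fromℚᵘ (toℚᵘ (fromℚᵘ p) ℚᵘ.+ toℚᵘ (fromℚᵘ r))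
    ≡⟨ ℚₚ.fromℚᵘ-cong (ℚᵘₚ.≃-sym (ℚₚ.toℚᵘ-homo-+ (fromℚᵘ p) (fromℚᵘ r))) ⟩
  fromℚᵘ (toℚᵘ (fromℚᵘ p ℚ.+ fromℚᵘ r))
    ≡⟨ ℚₚ.fromℚᵘ-toℚᵘ (fromℚᵘ p ℚ.+ fromℚᵘ r) ⟩
  fromℚᵘ p ℚ.+ fromℚᵘ r ∎
  where open ≡-Reasoning

fromℚᵘ-homo-* : ∀ p r → fromℚᵘ (p ℚᵘ.* r) ≡ fromℚᵘ p ℚ.* fromℚᵘ r
fromℚᵘ-homo-* p r = begin
  fromℚᵘ (p ℚᵘ.* r)
    ≡⟨ ℚₚ.fromℚᵘ-cong (ℚᵘₚ.*-cong (ℚᵘₚ.≃-sym (ℚₚ.toℚᵘ-fromℚᵘ p))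
                                  (ℚᵘₚ.≃-sym (ℚₚ.toℚᵘ-fromℚᵘ r))) ⟩
  fromℚᵘ (toℚᵘ (fromℚᵘ p) ℚᵘ.* toℚᵘ (fromℚᵘ r))
    ≡⟨ ℚₚ.fromℚᵘ-cong (ℚᵘₚ.≃-sym (ℚₚ.toℚᵘ-homo-* (fromℚᵘ p) (fromℚᵘ r))) ⟩
  fromℚᵘ (toℚᵘ (fromℚᵘ p ℚ.* fromℚᵘ r))
    ≡⟨ ℚₚ.fromℚᵘ-toℚᵘ (fromℚᵘ p ℚ.* fromℚᵘ r) ⟩
  fromℚᵘ p ℚ.* fromℚᵘ r ∎
  where open ≡-Reasoning

-- a /1+ k is the fraction a / (1 + k). k ⊗ l and ⨂ k are the predecessors of (1 + k) * (1 + l)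
-- and ∏ᵢ (1 + k i), so that products of such fractions are again of this form.
_/1+_ : ℕ → ℕ → ℚ
a /1+ k = ℤ.+ a ℚ./ suc k

_⊗_ : ℕ → ℕ → ℕ
k ⊗ l = pred (suc k * suc l)

⨂ : ∀ {n} → (Fin n → ℕ) → ℕ
⨂ = foldr _⊗_ 0

/1+-cross : ∀ a k b l → a * suc l ≡ b * suc k → a /1+ k ≡ b /1+ l
/1+-cross a k b l eq = ℚₚ.fromℚᵘ-cong {mkℚᵘ (ℤ.+ a) k} {mkℚᵘ (ℤ.+ b) l}
  (*≡* (trans (sym (pos-* a (suc l))) (trans (cong ℤ.+_ eq) (pos-* b (suc k)))))

+-/1+ : ∀ a k b l → a /1+ k ℚ.+ b /1+ l ≡ (a * suc l + b * suc k) /1+ (k ⊗ l)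
+-/1+ a k b l = trans (sym (fromℚᵘ-homo-+ (mkℚᵘ (ℤ.+ a) k) (mkℚᵘ (ℤ.+ b) l)))
  (cong (λ z → z ℚ./ suc (k ⊗ l)) (sym (trans (pos-+ (a * suc l) (b * suc k))
                                             (cong₂ ℤ._+_ (pos-* a (suc l)) (pos-* b (suc k))))))

+-/1+-same : ∀ a b k → a /1+ k ℚ.+ b /1+ k ≡ (a + b) /1+ k
+-/1+-same a b k = trans (+-/1+ a k b k) (/1+-cross (a * suc k + b * suc k) (k ⊗ k) (a + b) k
  (trans (cong (_* suc k) (sym (*-distribʳ-+ (suc k) a b))) (*-assoc (a + b) (suc k) (suc k))))

*-/1+ : ∀ a k b l → a /1+ k ℚ.* b /1+ l ≡ (a * b) /1+ (k ⊗ l)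
*-/1+ a k b l = trans (sym (fromℚᵘ-homo-* (mkℚᵘ (ℤ.+ a) k) (mkℚᵘ (ℤ.+ b) l)))
  (cong (λ z → z ℚ./ suc (k ⊗ l)) (sym (pos-* a b)))

/1+-nonZero : ∀ b k → NonZero (suc b /1+ k)
/1+-nonZero b k = ℚₚ.pos⇒nonZero (suc b /1+ k) {{ℚₚ.normalize-pos (suc b) (suc k)}}

sumℚ-/1+ : ∀ (xs : List A) (f : A → ℕ) {F : A → ℚ} {k} → (∀ x → F x ≡ f x /1+ k) →
  sumℚ (map F xs) ≡ ∑ xs f /1+ k
sumℚ-/1+ []       f {k = k} F≡ = /1+-cross 0 0 0 k refl
sumℚ-/1+ (x ∷ xs) f {k = k} F≡ =
  trans (cong₂ ℚ._+_ (F≡ x) (sumℚ-/1+ xs f F≡)) (+-/1+-same (f x) (∑ xs f) k)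

prodℚ-/1+ : ∀ {n} (a k : Fin n → ℕ) {F : Fin n → ℚ} → (∀ i → F i ≡ a i /1+ k i) →
  prodℚ (tabulate F) ≡ ∏ a /1+ ⨂ k
prodℚ-/1+ {zero}  a k F≡ = refl
prodℚ-/1+ {suc n} a k F≡ =
  trans (cong₂ ℚ._*_ (F≡ zero) (prodℚ-/1+ (a ∘ suc) (k ∘ suc) (F≡ ∘ suc)))
        (*-/1+ (a zero) (k zero) (∏ (a ∘ suc)) (⨂ (k ∘ suc)))

÷-/1+ : ∀ {x y} a b k → x ≡ a /1+ k → y ≡ suc b /1+ k → .{{_ : NonZero y}} → x ÷ y ≡ a /1+ b
÷-/1+ a b k refl refl = begin
  a /1+ k ℚ.* 1/ y          ≡⟨ cong (ℚ._* 1/ y) split ⟩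
  (a /1+ b ℚ.* y) ℚ.* 1/ y  ≡⟨ ℚₚ.*-assoc (a /1+ b) y (1/ y) ⟩
  a /1+ b ℚ.* (y ℚ.* 1/ y)  ≡⟨ cong (a /1+ b ℚ.*_) (ℚₚ.*-inverseʳ y) ⟩
  a /1+ b ℚ.* 1ℚ            ≡⟨ ℚₚ.*-identityʳ (a /1+ b) ⟩
  a /1+ b                   ∎
  where
  open ≡-Reasoning
  y : ℚ
  y = suc b /1+ k
  split : a /1+ k ≡ a /1+ b ℚ.* y
  split = trans (/1+-cross a k (a * suc b) (b ⊗ k) (sym (*-assoc a (suc b) (suc k))))
                (sym (*-/1+ a b (suc b) k))

module _ {q : ℕ} where

  -- Enumerations of maps Fin n → Fin q

  eqFun-cong : ∀ {n} {f f′ g : Fin n → Fin q} → f ≗ f′ → eqFun f g ≡ eqFun f′ g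
  eqFun-cong {n} {g = g} f≗f′ = all-cong (allFin n) (λ j → cong (λ x → ⌊ x ≟ g j ⌋) (f≗f′ j))

  eqFun-comm : ∀ {n} (f g : Fin n → Fin q) → eqFun f g ≡ eqFun g f
  eqFun-comm {n} f g = all-cong (allFin n) (λ j → ⌊≟⌋-sym (f j) (g j))

  𝟙-eqFun-suc : ∀ {n} (f g : Fin (suc n) → Fin q) →
    𝟙 (eqFun f g) ≡ 𝟙 ⌊ f zero ≟ g zero ⌋ * 𝟙 (eqFun (f ∘ suc) (g ∘ suc))
  𝟙-eqFun-suc f g = trans (𝟙-all-tabulate (λ j → ⌊ f j ≟ g j ⌋) id)
    (cong (𝟙 ⌊ f zero ≟ g zero ⌋ *_) (sym (𝟙-all-tabulate (λ j → ⌊ f (suc j) ≟ g (suc j) ⌋) id)))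

  -- τs lists every map exactly once up to pointwise equality (the only equality available on
  -- functions), expressed by the sifting property of the Kronecker delta 𝟙 (eqFun τ ρ).
  Sifting : ∀ {n} → List (Fin n → Fin q) → Set
  Sifting {n} τs = ∀ (ρ : Fin n → Fin q) (h : (Fin n → Fin q) → ℕ) →
    h Preserves _≗_ ⟶ _≡_ → ∑[ τ ∈ τs ] 𝟙 (eqFun τ ρ) * h τ ≡ h ρ

  sifting-[] : (f₀ : Fin 0 → Fin q) → Sifting (f₀ ∷ [])
  sifting-[] f₀ ρ h h-resp =
    trans (+-identityʳ (h f₀ + 0)) (trans (+-identityʳ (h f₀)) (h-resp (λ ())))

  -- cons stands for the pattern-matching lambda with which allFuns extends a map; as that lambda
  -- cannot be named here, only its two computation rules are assumed.
  sifting-step : ∀ {n} (cons : Fin q → (Fin n → Fin q) → Fin (suc n) → Fin q) →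
    (∀ a f → cons a f zero ≡ a) → (∀ a f i → cons a f (suc i) ≡ f i) →
    ∀ {fs} → Sifting fs → Sifting (concatMap (λ a → map (cons a) fs) (allFin q))
  sifting-step {n} cons cons-zero cons-suc {fs} sift ρ h h-resp = begin
    ∑[ τ ∈ concatMap (λ a → map (cons a) fs) (allFin q) ] 𝟙 (eqFun τ ρ) * h τ
      ≡⟨ ∑-concatMap-map cons (allFin q) fs (λ τ → 𝟙 (eqFun τ ρ) * h τ) ⟩
    ∑[ a ∈ allFin q ] ∑[ f ∈ fs ] 𝟙 (eqFun (cons a f) ρ) * h (cons a f)
      ≡⟨ ∑-cong (allFin q) (λ a → ∑-cong fs (split a)) ⟩
    ∑[ a ∈ allFin q ] ∑[ f ∈ fs ] δ a * (𝟙 (eqFun f ρ′) * h (cons a f))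
      ≡⟨ ∑-cong (allFin q) (λ a → *-distribˡ-∑ (δ a) fs (λ f → 𝟙 (eqFun f ρ′) * h (cons a f))) ⟨
    ∑[ a ∈ allFin q ] δ a * (∑[ f ∈ fs ] 𝟙 (eqFun f ρ′) * h (cons a f))
      ≡⟨ ∑-cong (allFin q) (λ a → cong (δ a *_) (sift ρ′ (h ∘ cons a) (h-resp ∘ cons-cong a))) ⟩
    ∑[ a ∈ allFin q ] δ a * h (cons a ρ′)
      ≡⟨ ∑-allFin-select (ρ zero) (λ a → h (cons a ρ′)) ⟩
    h (cons (ρ zero) ρ′)
      ≡⟨ h-resp cons-η ⟩
    h ρ ∎
    where
    open ≡-Reasoning
    ρ′ : Fin n → Fin q
    ρ′ = ρ ∘ suc
    δ : Fin q → ℕ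
    δ a = 𝟙 ⌊ a ≟ ρ zero ⌋
    split : ∀ a f → 𝟙 (eqFun (cons a f) ρ) * h (cons a f) ≡ δ a * (𝟙 (eqFun f ρ′) * h (cons a f))
    split a f = trans (cong (_* h (cons a f)) (trans (𝟙-eqFun-suc (cons a f) ρ)
        (cong₂ (λ x y → 𝟙 ⌊ x ≟ ρ zero ⌋ * 𝟙 y) (cons-zero a f) (eqFun-cong (cons-suc a f)))))
      (*-assoc (δ a) _ _)
    cons-cong : ∀ a {f f′} → f ≗ f′ → cons a f ≗ cons a f′
    cons-cong a f≗f′ zero    = trans (cons-zero a _) (sym (cons-zero a _))
    cons-cong a f≗f′ (suc i) = trans (cons-suc a _ i) (trans (f≗f′ i) (sym (cons-suc a _ i)))
    cons-η : cons (ρ zero) ρ′ ≗ ρ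
    cons-η zero    = cons-zero _ _
    cons-η (suc i) = cons-suc _ _ i

  allFuns-sifting : ∀ n → Sifting (allFuns {q} (allFin q) n)
  allFuns-sifting zero    = sifting-[] _
  allFuns-sifting (suc n) = sifting-step _ (λ _ _ → refl) (λ _ _ _ → refl) (allFuns-sifting n)

  ≤-∑-allFuns : ∀ {n} (h : (Fin n → Fin q) → ℕ) → h Preserves _≗_ ⟶ _≡_ →
    ∀ ρ → h ρ ≤ ∑[ τ ∈ allFuns {q} (allFin q) n ] h τ
  ≤-∑-allFuns {n} h h-resp ρ = ≤-trans (≤-reflexive (sym (allFuns-sifting n ρ h h-resp)))
    (∑-mono-≤ (allFuns {q} (allFin q) n) (λ τ → 𝟙-*-≤ (eqFun τ ρ) (h τ)))

  ∑-allDep-∏ : ∀ n (B : Fin n → Set) (ls : (i : Fin n) → List (B i)) (g : ∀ i → B i → ℕ) →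
    ∑[ cs ∈ allDep {q} n B ls ] ∏ (λ i → g i (cs i)) ≡ ∏ (λ i → ∑ (ls i) (g i))
  ∑-allDep-∏ zero    B ls g = refl
  ∑-allDep-∏ (suc n) B ls g = begin
    ∑[ cs ∈ allDep {q} (suc n) B ls ] ∏ (λ i → g i (cs i))
      ≡⟨ ∑-concatMap-map _ (ls zero) rest (λ cs → ∏ (λ i → g i (cs i))) ⟩
    ∑[ b ∈ ls zero ] ∑[ cs ∈ rest ] g zero b * ∏ (λ i → g (suc i) (cs i))
      ≡⟨ ∑-cong (ls zero) (λ b → *-distribˡ-∑ (g zero b) rest _) ⟨
    ∑[ b ∈ ls zero ] g zero b * (∑[ cs ∈ rest ] ∏ (λ i → g (suc i) (cs i)))
      ≡⟨ ∑-cong (ls zero) (λ b → cong (g zero b *_) (∑-allDep-∏ n (B ∘ suc) (ls ∘ suc) (g ∘ suc))) ⟩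
    ∑[ b ∈ ls zero ] g zero b * ∏ (λ i → ∑ (ls (suc i)) (g (suc i)))
      ≡⟨ *-distribʳ-∑ _ (ls zero) (g zero) ⟨
    ∑ (ls zero) (g zero) * ∏ (λ i → ∑ (ls (suc i)) (g (suc i))) ∎
    where
    open ≡-Reasoning
    rest : List ((i : Fin n) → B (suc i))
    rest = allDep {q} n (B ∘ suc) (ls ∘ suc)

  -- Counting proper colorings

  notUsed-cong : ∀ {n} (a : Fin q) {τ τ′ : Fin n → Fin q} → τ ≗ τ′ → notUsed a τ ≡ notUsed a τ′
  notUsed-cong {n} a τ≗τ′ = all-cong (allFin n) (λ j → cong (λ x → not ⌊ a ≟ x ⌋) (τ≗τ′ j))

  -- The distinctness test of isBroomColoring uses a disjunction local to its definition, which
  -- cannot be named here; so rather than rewriting pointwise we refute a separating pair (i, j).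
  isBroomColoring-resp : ∀ u {τ τ′ : Fin (deg u) → Fin q} → τ ≗ τ′ →
    isBroomColoring u τ ≡ true → isBroomColoring u τ′ ≡ true
  isBroomColoring-resp (node d L ch) {τ} {τ′} τ≗τ′ broom
    with isBroomColoring (node d L ch) τ′ in broom′
  ... | true  = refl
  ... | false with ∧-separates broom broom′
  ...   | inj₁ (inLists , inLists′) with all-separates (allFin d) inLists inLists′
  ...     | i , τi∈L , τ′i∉L =
    contradiction (trans (sym τi∈L) (trans (cong (lookup (L i)) (τ≗τ′ i)) τ′i∉L)) λ ()
  isBroomColoring-resp (node d L ch) {τ} {τ′} τ≗τ′ broom | false | inj₂ (distinct , distinct′)
    with all-separates (allFin d) distinct distinct′
  ... | i , row , row′ with all-separates (allFin d) row row′
  ... | j , entry , entry′ with i ≟ j | τ i ≟ τ j | τ′ i ≟ τ′ j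
  ... | yes _ | _        | _           = contradiction entry′ λ ()
  ... | no _  | yes _    | _           = contradiction entry λ ()
  ... | no _  | no _     | no _        = contradiction entry′ λ ()
  ... | no _  | no τi≢τj | yes τ′i≡τ′j =
    contradiction (trans (τ≗τ′ i) (trans τ′i≡τ′j (sym (τ≗τ′ j)))) τi≢τj

  isBroomColoring-cong : ∀ u {τ τ′ : Fin (deg u) → Fin q} → τ ≗ τ′ →
    isBroomColoring u τ ≡ isBroomColoring u τ′
  isBroomColoring-cong u τ≗τ′ =
    ⇔→≡ {z = true} (mk⇔ (isBroomColoring-resp u τ≗τ′) (isBroomColoring-resp u (sym ∘ τ≗τ′)))

  𝟙-isProper-broom : ∀ (u : LTree q) (c : Coloring u) →
    𝟙 (isProper u c) * 𝟙 (isBroomColoring u (rootColors u c)) ≡ 𝟙 (isProper u c)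
  𝟙-isProper-broom (node d L ch) (f , cs) with isBroomColoring (node d L ch) f
  ... | true  = *-identityʳ _
  ... | false = refl

  𝟙-isProper-node : ∀ d L ch (f : Fin d → Fin q) (cs : (i : Fin d) → Coloring (ch i)) →
    𝟙 (isProper (node d L ch) (f , cs)) ≡
    𝟙 (isBroomColoring (node d L ch) f) *
    ∏ (λ i → 𝟙 (isProper (ch i) (cs i)) * 𝟙 (notUsed (f i) (rootColors (ch i) (cs i))))
  𝟙-isProper-node d L ch f cs = begin
    𝟙 (broom ∧ allFinB {q} d avoids ∧ allFinB {q} d proper)
      ≡⟨ 𝟙-∧ broom _ ⟩
    𝟙 broom * 𝟙 (allFinB {q} d avoids ∧ allFinB {q} d proper)
      ≡⟨ cong (𝟙 broom *_) (𝟙-∧ (allFinB {q} d avoids) _) ⟩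
    𝟙 broom * (𝟙 (allFinB {q} d avoids) * 𝟙 (allFinB {q} d proper))
      ≡⟨ cong (𝟙 broom *_) (cong₂ _*_ (𝟙-all-tabulate avoids id) (𝟙-all-tabulate proper id)) ⟩
    𝟙 broom * (∏ (λ i → 𝟙 (avoids i)) * ∏ (λ i → 𝟙 (proper i)))
      ≡⟨ cong (𝟙 broom *_) (∏-distrib-* (λ i → 𝟙 (avoids i)) (λ i → 𝟙 (proper i))) ⟨
    𝟙 broom * ∏ (λ i → 𝟙 (avoids i) * 𝟙 (proper i))
      ≡⟨ cong (𝟙 broom *_) (∏-cong (λ i → *-comm (𝟙 (avoids i)) (𝟙 (proper i)))) ⟩
    𝟙 broom * ∏ (λ i → 𝟙 (proper i) * 𝟙 (avoids i)) ∎
    where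
    open ≡-Reasoning
    broom : Bool
    broom = isBroomColoring (node d L ch) f
    avoids proper : Fin d → Bool
    avoids i = notUsed (f i) (rootColors (ch i) (cs i))
    proper i = isProper (ch i) (cs i)

  #proper : (u : LTree q) → ((Fin (deg u) → Fin q) → ℕ) → ℕ
  #proper u X = ∑[ c ∈ allColorings u ] 𝟙 (isProper u c) * X (rootColors u c)

  #withRoot : (u : LTree q) → (Fin (deg u) → Fin q) → ℕ
  #withRoot u τ = #proper u (λ ρ → 𝟙 (eqFun ρ τ))

  #avoiding : LTree q → Fin q → ℕ
  #avoiding u a = #proper u (λ τ → 𝟙 (notUsed a τ))

  -- The number of proper colorings of node d L ch whose root broom is f (see #proper-node).
  #extensions : ∀ d → (Fin d → Subset q) → (Fin d → LTree q) → (Fin d → Fin q) → ℕ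
  #extensions d L ch f = 𝟙 (isBroomColoring (node d L ch) f) * ∏ (λ i → #avoiding (ch i) (f i))

  #extensions-cong : ∀ d L ch {f f′ : Fin d → Fin q} → f ≗ f′ →
    #extensions d L ch f ≡ #extensions d L ch f′
  #extensions-cong d L ch f≗f′ = cong₂ (λ b n → 𝟙 b * n) (isBroomColoring-cong (node d L ch) f≗f′)
                                       (∏-cong (λ i → cong (#avoiding (ch i)) (f≗f′ i)))

  #proper-node : ∀ d L ch (X : (Fin d → Fin q) → ℕ) →
    #proper (node d L ch) X ≡ ∑[ f ∈ allFuns {q} (allFin q) d ] X f * #extensions d L ch f
  #proper-node d L ch X = begin
    #proper (node d L ch) X
      ≡⟨ ∑-concatMap-map _,_ fs css (λ c → 𝟙 (isProper (node d L ch) c) * X (proj₁ c)) ⟩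
    ∑[ f ∈ fs ] ∑[ cs ∈ css ] 𝟙 (isProper (node d L ch) (f , cs)) * X f
      ≡⟨ ∑-cong fs (λ f → ∑-cong css (reorder f)) ⟩
    ∑[ f ∈ fs ] ∑[ cs ∈ css ] X f * (𝟙 (broom f) * ∏ (λ i → extends f i (cs i)))
      ≡⟨ ∑-cong fs pull-out ⟨
    ∑[ f ∈ fs ] X f * (𝟙 (broom f) * (∑[ cs ∈ css ] ∏ (λ i → extends f i (cs i))))
      ≡⟨ ∑-cong fs (λ f → cong (λ n → X f * (𝟙 (broom f) * n))
                               (∑-allDep-∏ d _ (λ i → allColorings (ch i)) (extends f))) ⟩
    ∑[ f ∈ fs ] X f * #extensions d L ch f ∎
    where
    open ≡-Reasoning
    fs : List (Fin d → Fin q)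
    fs = allFuns {q} (allFin q) d
    css : List ((i : Fin d) → Coloring (ch i))
    css = allDep {q} d (λ i → Coloring (ch i)) (λ i → allColorings (ch i))
    broom : (Fin d → Fin q) → Bool
    broom = isBroomColoring (node d L ch)
    extends : (f : Fin d → Fin q) (i : Fin d) → Coloring (ch i) → ℕ
    extends f i c = 𝟙 (isProper (ch i) c) * 𝟙 (notUsed (f i) (rootColors (ch i) c))
    reorder : ∀ f cs →
      𝟙 (isProper (node d L ch) (f , cs)) * X f ≡ X f * (𝟙 (broom f) * ∏ (λ i → extends f i (cs i)))
    reorder f cs = trans (cong (_* X f) (𝟙-isProper-node d L ch f cs)) (*-comm _ (X f))
    pull-out : ∀ f → X f * (𝟙 (broom f) * (∑[ cs ∈ css ] ∏ (λ i → extends f i (cs i))))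
                     ≡ ∑[ cs ∈ css ] X f * (𝟙 (broom f) * ∏ (λ i → extends f i (cs i)))
    pull-out f = trans (cong (X f *_) (*-distribˡ-∑ (𝟙 (broom f)) css _)) (*-distribˡ-∑ (X f) css _)

  #withRoot-node : ∀ d L ch (π : Fin d → Fin q) → isBroomColoring (node d L ch) π ≡ true →
    #withRoot (node d L ch) π ≡ ∏ (λ i → #avoiding (ch i) (π i))
  #withRoot-node d L ch π broom = begin
    #withRoot (node d L ch) π
      ≡⟨ #proper-node d L ch (λ τ → 𝟙 (eqFun τ π)) ⟩
    ∑[ f ∈ allFuns {q} (allFin q) d ] 𝟙 (eqFun f π) * #extensions d L ch f
      ≡⟨ allFuns-sifting d π (#extensions d L ch) (#extensions-cong d L ch) ⟩
    #extensions d L ch π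
      ≡⟨ cong (λ b → 𝟙 b * _) broom ⟩
    1 * ∏ (λ i → #avoiding (ch i) (π i))
      ≡⟨ *-identityˡ _ ⟩
    ∏ (λ i → #avoiding (ch i) (π i)) ∎
    where open ≡-Reasoning

  #proper-by-root : ∀ (u : LTree q) (Z : (Fin (deg u) → Fin q) → ℕ) → Z Preserves _≗_ ⟶ _≡_ →
    ∑[ τ ∈ allFuns {q} (allFin q) (deg u) ] Z τ * #withRoot u τ ≡ #proper u Z
  #proper-by-root u Z Z-resp = begin
    ∑[ τ ∈ τs ] Z τ * (∑[ c ∈ cs ] 𝟙 (isProper u c) * 𝟙 (eqFun (root c) τ))
      ≡⟨ ∑-cong τs (λ τ → *-distribˡ-∑ (Z τ) cs _) ⟩
    ∑[ τ ∈ τs ] ∑[ c ∈ cs ] Z τ * (𝟙 (isProper u c) * 𝟙 (eqFun (root c) τ))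
      ≡⟨ ∑-comm τs cs _ ⟩
    ∑[ c ∈ cs ] ∑[ τ ∈ τs ] Z τ * (𝟙 (isProper u c) * 𝟙 (eqFun (root c) τ))
      ≡⟨ ∑-cong cs (λ c → ∑-cong τs (λ τ →
           x*yz≡y*zx (Z τ) (𝟙 (isProper u c)) (𝟙 (eqFun (root c) τ)))) ⟩
    ∑[ c ∈ cs ] ∑[ τ ∈ τs ] 𝟙 (isProper u c) * (𝟙 (eqFun (root c) τ) * Z τ)
      ≡⟨ ∑-cong cs (λ c → *-distribˡ-∑ (𝟙 (isProper u c)) τs _) ⟨
    ∑[ c ∈ cs ] 𝟙 (isProper u c) * (∑[ τ ∈ τs ] 𝟙 (eqFun (root c) τ) * Z τ)
      ≡⟨ ∑-cong cs (λ c → cong (𝟙 (isProper u c) *_) (sifted c)) ⟩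
    #proper u Z ∎
    where
    open ≡-Reasoning
    τs : List (Fin (deg u) → Fin q)
    τs = allFuns {q} (allFin q) (deg u)
    cs : List (Coloring u)
    cs = allColorings u
    root : Coloring u → Fin (deg u) → Fin q
    root = rootColors u
    sifted : ∀ c → ∑[ τ ∈ τs ] 𝟙 (eqFun (root c) τ) * Z τ ≡ Z (root c)
    sifted c = trans (∑-cong τs (λ τ → cong (λ b → 𝟙 b * Z τ) (eqFun-comm (root c) τ)))
                     (allFuns-sifting (deg u) (root c) Z Z-resp)

  #proper-broom : ∀ (u : LTree q) (Z : (Fin (deg u) → Fin q) → ℕ) →
    #proper u (λ τ → 𝟙 (isBroomColoring u τ) * Z τ) ≡ #proper u Z
  #proper-broom u Z = ∑-cong (allColorings u) λ c →
    trans (sym (*-assoc (𝟙 (isProper u c)) _ _)) (cong (_* Z (rootColors u c)) (𝟙-isProper-broom u c))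

  ∑-withRoot-avoiding : ∀ (u : LTree q) (a : Fin q) →
    ∑[ τ ∈ filter (λ τ → notUsed a τ ≟ᵇ true) (C u) ] #withRoot u τ ≡ #avoiding u a
  ∑-withRoot-avoiding u a = begin
    ∑[ τ ∈ filter (λ τ → notUsed a τ ≟ᵇ true) (C u) ] #withRoot u τ
      ≡⟨ ∑-filter (notUsed a) (C u) (#withRoot u) ⟩
    ∑[ τ ∈ C u ] 𝟙 (notUsed a τ) * #withRoot u τ
      ≡⟨ ∑-filter (isBroomColoring u) τs _ ⟩
    ∑[ τ ∈ τs ] 𝟙 (isBroomColoring u τ) * (𝟙 (notUsed a τ) * #withRoot u τ)
      ≡⟨ ∑-cong τs (λ τ → sym (*-assoc (𝟙 (isBroomColoring u τ)) _ _)) ⟩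
    ∑[ τ ∈ τs ] 𝟙 (isBroomColoring u τ) * 𝟙 (notUsed a τ) * #withRoot u τ
      ≡⟨ #proper-by-root u (λ τ → 𝟙 (isBroomColoring u τ) * 𝟙 (notUsed a τ)) resp ⟩
    #proper u (λ τ → 𝟙 (isBroomColoring u τ) * 𝟙 (notUsed a τ))
      ≡⟨ #proper-broom u (λ τ → 𝟙 (notUsed a τ)) ⟩
    #avoiding u a ∎
    where
    open ≡-Reasoning
    τs : List (Fin (deg u) → Fin q)
    τs = allFuns {q} (allFin q) (deg u)
    resp : (λ τ → 𝟙 (isBroomColoring u τ) * 𝟙 (notUsed a τ)) Preserves _≗_ ⟶ _≡_
    resp τ≗τ′ = cong₂ (λ b b′ → 𝟙 b * 𝟙 b′) (isBroomColoring-cong u τ≗τ′) (notUsed-cong a τ≗τ′)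

  term≤#proper : ∀ (u : LTree q) (X : (Fin (deg u) → Fin q) → ℕ) → X Preserves _≗_ ⟶ _≡_ →
    ∀ c → 𝟙 (isProper u c) * X (rootColors u c) ≤ #proper u X
  term≤#proper (node d L ch) X X-resp (f , cs) = begin
    𝟙 (isProper (node d L ch) (f , cs)) * X f
      ≡⟨ cong (_* X f) (𝟙-isProper-node d L ch f cs) ⟩
    𝟙 (broom f) * ∏ (λ i → 𝟙 (isProper (ch i) (cs i)) * 𝟙 (avoids i (cs i))) * X f
      ≤⟨ *-monoˡ-≤ (X f) (*-monoʳ-≤ (𝟙 (broom f)) (∏-mono-≤ child≤)) ⟩
    #extensions d L ch f * X f
      ≡⟨ *-comm _ (X f) ⟩
    X f * #extensions d L ch f
      ≤⟨ ≤-∑-allFuns (λ g → X g * #extensions d L ch g) resp f ⟩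
    ∑[ g ∈ allFuns {q} (allFin q) d ] X g * #extensions d L ch g
      ≡⟨ #proper-node d L ch X ⟨
    #proper (node d L ch) X ∎
    where
    open ≤-Reasoning
    broom : (Fin d → Fin q) → Bool
    broom = isBroomColoring (node d L ch)
    avoids : (i : Fin d) → Coloring (ch i) → Bool
    avoids i c = notUsed (f i) (rootColors (ch i) c)
    child≤ : ∀ i → 𝟙 (isProper (ch i) (cs i)) * 𝟙 (avoids i (cs i)) ≤ #avoiding (ch i) (f i)
    child≤ i = term≤#proper (ch i) (λ τ → 𝟙 (notUsed (f i) τ)) (cong 𝟙 ∘ notUsed-cong (f i)) (cs i)
    resp : (λ g → X g * #extensions d L ch g) Preserves _≗_ ⟶ _≡_
    resp g≗g′ = cong₂ _*_ (X-resp g≗g′) (#extensions-cong d L ch g≗g′)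

  length-filter-properColorings : ∀ (u : LTree q) (E : Coloring u → Bool) →
    length (filter (λ c → E c ≟ᵇ true) (properColorings u))
      ≡ ∑[ c ∈ allColorings u ] 𝟙 (isProper u c) * 𝟙 (E c)
  length-filter-properColorings u E =
    trans (length-filter E (properColorings u)) (∑-filter (isProper u) (allColorings u) (𝟙 ∘ E))

  length-properColorings : ∀ (u : LTree q) → length (properColorings u) ≡ #proper u (λ _ → 1)
  length-properColorings u = trans (length-filter (isProper u) (allColorings u))
    (∑-cong (allColorings u) (λ c → sym (*-identityʳ (𝟙 (isProper u c)))))

  length-properColorings-node : ∀ d L ch →
    length (properColorings (node d L ch)) ≡ ∑[ ρ ∈ C (node d L ch) ] ∏ (λ i → #avoiding (ch i) (ρ i))
  length-properColorings-node d L ch = begin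
    length (properColorings (node d L ch))
      ≡⟨ length-properColorings (node d L ch) ⟩
    #proper (node d L ch) (λ _ → 1)
      ≡⟨ #proper-node d L ch (λ _ → 1) ⟩
    ∑[ f ∈ fs ] 1 * #extensions d L ch f
      ≡⟨ ∑-cong fs (λ f → *-identityˡ _) ⟩
    ∑[ f ∈ fs ] 𝟙 (isBroomColoring (node d L ch) f) * ∏ (λ i → #avoiding (ch i) (f i))
      ≡⟨ ∑-filter (isBroomColoring (node d L ch)) fs _ ⟨
    ∑[ ρ ∈ C (node d L ch) ] ∏ (λ i → #avoiding (ch i) (ρ i)) ∎
    where
    open ≡-Reasoning
    fs : List (Fin d → Fin q)
    fs = allFuns {q} (allFin q) d

  properColorings-nonempty : ∀ (u : LTree q) → HasProperColoring u → 0 < length (properColorings u)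
  properColorings-nonempty u (c , proper) = begin
    1                           ≡⟨ cong (λ b → 𝟙 b * 1) (sym proper) ⟩
    𝟙 (isProper u c) * 1        ≤⟨ term≤#proper u (λ _ → 1) (λ _ → refl) c ⟩
    #proper u (λ _ → 1)         ≡⟨ sym (length-properColorings u) ⟩
    length (properColorings u)  ∎
    where open ≤-Reasoning

  length≡suc-pred : ∀ (u : LTree q) → HasProperColoring u →
    length (properColorings u) ≡ suc (pred (length (properColorings u)))
  length≡suc-pred u hasProper = sym (suc-pred _ {{>-nonZero (properColorings-nonempty u hasProper)}})

  HasProperColoring-child : ∀ {d L} {ch : Fin d → LTree q} → HasProperColoring (node d L ch) →
    ∀ i → HasProperColoring (ch i)
  HasProperColoring-child {d} {L} {ch} ((f , cs) , proper) i = cs i , all-true children-proper (∈-allFin i)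
    where
    avoids : Bool
    avoids = allFinB {q} d (λ i → notUsed (f i) (rootColors (ch i) (cs i)))
    children-proper : allFinB {q} d (λ i → isProper (ch i) (cs i)) ≡ true
    children-proper = proj₂ (∧-true {avoids} (proj₂ (∧-true {isBroomColoring (node d L ch) f} proper)))

  Pr-/1+ : ∀ (u : LTree q) (E : Coloring u → Bool) {m} → length (properColorings u) ≡ suc m →
    Pr u E ≡ length (filter (λ c → E c ≟ᵇ true) (properColorings u)) /1+ m
  Pr-/1+ u E N≡ with length (properColorings u) | N≡
  ... | _ | refl = refl

  pvec-/1+ : ∀ (u : LTree q) {m} → length (properColorings u) ≡ suc m →
    ∀ τ → pvec u τ ≡ #withRoot u τ /1+ m
  pvec-/1+ u {m} N≡ τ = trans (Pr-/1+ u (λ c → eqFun (rootColors u c) τ) N≡)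
    (cong (_/1+ m) (length-filter-properColorings u (λ c → eqFun (rootColors u c) τ)))

  module _ (d : ℕ) (ch : Fin d → LTree q) (k : Fin d → ℕ)
           (N≡ : ∀ i → length (properColorings (ch i)) ≡ suc (k i)) where

    weight-/1+ : ∀ ρ → weight d ch ρ ≡ ∏ (λ i → #avoiding (ch i) (ρ i)) /1+ ⨂ k
    weight-/1+ ρ = trans (cong prodℚ (map-tabulate id factor)) (prodℚ-/1+ _ k factor≡)
      where
      avoiding : (i : Fin d) → List (Fin (deg (ch i)) → Fin q)
      avoiding i = filter (λ τ → notUsed (ρ i) τ ≟ᵇ true) (C (ch i))
      factor : Fin d → ℚ
      factor i = sumℚ (map (pvec (ch i)) (avoiding i))
      factor≡ : ∀ i → factor i ≡ #avoiding (ch i) (ρ i) /1+ k i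
      factor≡ i = trans (sumℚ-/1+ (avoiding i) (#withRoot (ch i)) (pvec-/1+ (ch i) (N≡ i)))
                        (cong (_/1+ k i) (∑-withRoot-avoiding (ch i) (ρ i)))

    sum-weight-/1+ : ∀ L →
      sumℚ (map (weight d ch) (C (node d L ch))) ≡ length (properColorings (node d L ch)) /1+ ⨂ k
    sum-weight-/1+ L = trans (sumℚ-/1+ (C (node d L ch)) (λ ρ → ∏ (λ i → #avoiding (ch i) (ρ i))) weight-/1+)
                           (cong (_/1+ ⨂ k) (sym (length-properColorings-node d L ch)))

lemma3p3 : {q : ℕ} (d : ℕ) (L : Fin d → Subset q) (ch : Fin d → LTree q) →
    HasProperColoring (node d L ch) →
    (π : Fin d → Fin q) → isBroomColoring (node d L ch) π ≡ true →
    Σ (NonZero (sumℚ (map (weight d ch) (C (node d L ch)))))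
      (λ nz → Pr (node d L ch) (λ c → eqFun (rootColors (node d L ch) c) π)
              ≡ _÷_ (weight d ch π) (sumℚ (map (weight d ch) (C (node d L ch)))) {{nz}})
lemma3p3 {q} d L ch proper π π-broom = nonZero , Pr≡
  where
  open ≡-Reasoning
  t : LTree q
  t = node d L ch
  m : ℕ
  m = pred (length (properColorings t))
  k : Fin d → ℕ
  k i = pred (length (properColorings (ch i)))
  N≡ : ∀ i → length (properColorings (ch i)) ≡ suc (k i)
  N≡ i = length≡suc-pred (ch i) (HasProperColoring-child {L = L} proper i)
  ∏avoiding : (Fin d → Fin q) → ℕ
  ∏avoiding ρ = ∏ (λ i → #avoiding (ch i) (ρ i))
  total : ℚ
  total = sumℚ (map (weight d ch) (C t))
  total≡ : total ≡ suc m /1+ ⨂ k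
  total≡ = trans (sum-weight-/1+ d ch k N≡ L) (cong (_/1+ ⨂ k) (length≡suc-pred t proper))
  nonZero : NonZero total
  nonZero = subst NonZero (sym total≡) (/1+-nonZero m (⨂ k))
  Pr≡ : pvec t π ≡ _÷_ (weight d ch π) total {{nonZero}}
  Pr≡ = begin
    pvec t π
      ≡⟨ pvec-/1+ t (length≡suc-pred t proper) π ⟩
    #withRoot t π /1+ m
      ≡⟨ cong (_/1+ m) (#withRoot-node d L ch π π-broom) ⟩
    ∏avoiding π /1+ m
      ≡⟨ ÷-/1+ (∏avoiding π) m (⨂ k) (weight-/1+ d ch k N≡ π) total≡ {{nonZero}} ⟨
    _÷_ (weight d ch π) total {{nonZero}} ∎
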